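{- Let $\vdash$ be a regular entailment relation for a commutative preordered group $G$, let $A,B$ be nonempty finite subsets of $G$ and $x\in G$. If $A,A+x\vdash B$ and $A,A-x\vdash B$, then $A\vdash B$. Symmetrically, if $A\vdash B,B+x$ and $A\vdash B,B-x$, then $A\vdash B$.
   Context: A commutative preordered group is an abelian group $G$ with a preorder $\leqslant$ such that $a\leqslant b$ implies $a+c\leqslant b+c$. $A,B,A',B'$ denote nonempty finite subsets of $G$; $a$ stands for $\{a\}$, commas denote unions, $A\pm y=\{a\pm y:a\in A\}$. A regular entailment relation for $G$ is a relation $A\vdash B$ between nonempty finite subsets such that: (R1) $A\vdash B$ if $A\supseteq A'$, $B\supseteq B'$ and $A'\vdash B'$; (R2) $A\vdash B$ if $A,y\vdash B$ and $A\vdash B,y$; (R3) $a\vdash b$ if $a\leqslant b$; (R4) $A\vdash B$ if $A+y\vdash B+y$; (R5) $a+u,b+v\vdash a+b,u+v$ for all $a,b,u,v\in G$. -}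

module Defs where

open import Level using (Level; _⊔_; suc)
open import Algebra.Bundles using (AbelianGroup)
open import Relation.Binary.Structures using (IsPreorder)
open import Data.List.NonEmpty as L⁺ using (List⁺; [_]; _⁺++⁺_; _∷⁺_; toList)
open import Data.Product using (_×_)
import Data.List.Relation.Binary.Subset.Setoid as SubsetS

record CommPreorderedGroup (c ℓ₁ ℓ₂ : Level) : Set (suc (c ⊔ ℓ₁ ⊔ ℓ₂)) where
  field
    abelianGroup : AbelianGroup c ℓ₁
  open AbelianGroup abelianGroup public
  field
    _≤_ : Carrier → Carrier → Set ℓ₂
    isPreorder : IsPreorder _≈_ _≤_
    ≤-compat : ∀ {a b} c → a ≤ b → (a ∙ c) ≤ (b ∙ c)

module FinSubsets {c ℓ₁ ℓ₂ : Level} (G : CommPreorderedGroup c ℓ₁ ℓ₂) where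
  open CommPreorderedGroup G

  -- Nonempty finite subsets of G, represented by nonempty lists
  -- (only their underlying sets matter, see R1).
  FinSub : Set c
  FinSub = List⁺ Carrier

  _⊇_ : FinSub → FinSub → Set (c ⊔ ℓ₁)
  A ⊇ A′ = SubsetS._⊆_ setoid (toList A′) (toList A)

  _,,_ : FinSub → FinSub → FinSub
  A ,, B = A ⁺++⁺ B

  _,ᵉ_ : FinSub → Carrier → FinSub
  A ,ᵉ y = A ⁺++⁺ [ y ]

  _+ˢ_ : FinSub → Carrier → FinSub
  A +ˢ y = L⁺.map (λ a → a ∙ y) A

  _-ˢ_ : FinSub → Carrier → FinSub
  A -ˢ y = L⁺.map (λ a → a ∙ (y ⁻¹)) A

  record IsRegularEntailment {ℓ : Level} (_⊢_ : FinSub → FinSub → Set ℓ)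
         : Set (c ⊔ ℓ₁ ⊔ ℓ₂ ⊔ ℓ) where
    field
      R1 : ∀ {A B A′ B′} → A ⊇ A′ → B ⊇ B′ → A′ ⊢ B′ → A ⊢ B
      R2 : ∀ {A B y} → (A ,ᵉ y) ⊢ B → A ⊢ (B ,ᵉ y) → A ⊢ B
      R3 : ∀ {a b} → a ≤ b → [ a ] ⊢ [ b ]
      R4 : ∀ {A B y} → (A +ˢ y) ⊢ (B +ˢ y) → A ⊢ B
      R5 : ∀ a b u v → ((a ∙ u) ∷⁺ [ b ∙ v ]) ⊢ ((a ∙ b) ∷⁺ [ u ∙ v ])

-- Cutting successively on the elements a + x of A + x and a' - x of A - x
-- reduces the claim to  A ⊢ B, a + x, a' - x  for all a, a' ∈ A, which is
-- an instance of (R5):  a, (a' - x) + x ⊢ a + x, a' - x.  The second half is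
-- the first one for the converse entailment relation on the group with the
-- reversed preorder, which is again regular.
module Submission where

open import Defs
open import Level using (Level)
open import Function.Base using (flip)
open import Data.Product using (_×_; _,_)
open import Data.List using ([]; _∷_; _++_)
import Data.List as List
open import Data.List.Properties using (++-assoc; ++-identityʳ)
open import Data.List.NonEmpty using ([_]; _⁺++_; _∷⁺_; toList)
open import Data.List.Relation.Unary.Any as Any using (here; there)
import Data.List.Membership.Propositional as Propositional
open import Data.List.Membership.Propositional.Properties using (∈-map⁻)
import Data.List.Membership.Setoid as SetoidMembership
open import Data.List.Membership.Setoid.Properties using (∈-resp-≈)
import Data.List.Relation.Binary.Subset.Setoid as SetoidSubset
open import Data.List.Relation.Binary.Subset.Setoid.Properties
  using (⊆-refl; ⊆-reflexive; xs⊆xs++ys; xs⊆ys++xs; ++⁺ˡ)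
import Data.List.Relation.Binary.Equality.Setoid as SetoidEquality
import Algebra.Properties.AbelianGroup as AbelianGroupₚ
import Relation.Binary.Construct.Flip.EqAndOrd as Flip
import Relation.Binary.PropositionalEquality as ≡
open ≡ using (_≡_)

private
  variable
    c ℓ₁ ℓ₂ ℓ : Level

flip-≤ : CommPreorderedGroup c ℓ₁ ℓ₂ → CommPreorderedGroup c ℓ₁ ℓ₂
flip-≤ G = record
  { abelianGroup = abelianGroup
  ; _≤_          = flip _≤_
  ; isPreorder   = Flip.isPreorder isPreorder
  ; ≤-compat     = ≤-compat
  }
  where open CommPreorderedGroup G

module _ {G : CommPreorderedGroup c ℓ₁ ℓ₂} where
  open CommPreorderedGroup G
  open FinSubsets G
  open AbelianGroupₚ abelianGroup using (//-rightDividesˡ)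
  open SetoidMembership setoid using (_∈_)
  open SetoidSubset setoid using (_⊆_)
  open SetoidEquality setoid using (≋-reflexive)

  flip-isRegularEntailment : {_⊢_ : FinSub → FinSub → Set ℓ} →
    IsRegularEntailment _⊢_ → FinSubsets.IsRegularEntailment (flip-≤ G) (flip _⊢_)
  flip-isRegularEntailment R = record
    { R1 = λ A⊇A′ B⊇B′ → R1 B⊇B′ A⊇A′
    ; R2 = λ ⊢B,y A,y⊢ → R2 A,y⊢ ⊢B,y
    ; R3 = R3
    ; R4 = R4
    ; R5 = λ a b u v → R5 a u b v
    }
    where open IsRegularEntailment R

  pair⊆ : ∀ {p q xs} → p ∈ xs → q ∈ xs → (p ∷ q ∷ []) ⊆ xs
  pair⊆ p∈xs q∈xs (here z≈p)         = ∈-resp-≈ setoid (sym z≈p) p∈xs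
  pair⊆ p∈xs q∈xs (there (here z≈q)) = ∈-resp-≈ setoid (sym z≈q) q∈xs

  module _ {_⊢_ : FinSub → FinSub → Set ℓ} (R : IsRegularEntailment _⊢_) where
    open IsRegularEntailment R

    ⊢-weakenˡ : ∀ {C D} ys → C ⊢ D → (C ⁺++ ys) ⊢ D
    ⊢-weakenˡ {C} ys = R1 (xs⊆xs++ys setoid (toList C) ys) (⊆-refl setoid)

    ⊢-weakenʳ : ∀ {C D} ys → C ⊢ D → C ⊢ (D ⁺++ ys)
    ⊢-weakenʳ {D = D} ys = R1 (⊆-refl setoid) (xs⊆xs++ys setoid (toList D) ys)

    cut* : ∀ Y {C D} → (C ⁺++ Y) ⊢ D →
           (∀ {y} → y Propositional.∈ Y → C ⊢ (D ,ᵉ y)) → C ⊢ D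
    cut* [] {C} C⊢D _ =
      R1 (⊆-reflexive setoid (≋-reflexive (++-identityʳ (toList C)))) (⊆-refl setoid) C⊢D
    cut* (y ∷ Y) {C} {D} C,y,Y⊢D ⊢D,Y =
      R2 (cut* Y C,y,Y⊢D′ (λ y′∈Y → ⊢-weakenˡ (y ∷ []) (⊢D,Y (there y′∈Y))))
         (⊢D,Y (here ≡.refl))
      where
      reassociate : toList C ++ y ∷ Y ≡ (toList C ++ y ∷ []) ++ Y
      reassociate = ≡.sym (++-assoc (toList C) (y ∷ []) Y)

      C,y,Y⊢D′ : ((C ,ᵉ y) ⁺++ Y) ⊢ D
      C,y,Y⊢D′ = R1 (⊆-reflexive setoid (≋-reflexive reassociate)) (⊆-refl setoid) C,y,Y⊢D

    cut-map* : ∀ {a} {I : Set a} (f : I → Carrier) xs {C D} →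
               (C ⁺++ List.map f xs) ⊢ D →
               (∀ {i} → i Propositional.∈ xs → C ⊢ (D ,ᵉ f i)) → C ⊢ D
    cut-map* f xs {C} {D} C,fxs⊢D ⊢D,fxs = cut* (List.map f xs) C,fxs⊢D λ y∈fxs →
      let i , i∈xs , y≡fi = ∈-map⁻ f y∈fxs in
      ≡.subst (λ y → C ⊢ (D ,ᵉ y)) (≡.sym y≡fi) (⊢D,fxs i∈xs)

    R5-shift : ∀ a b x → (a ∷⁺ [ b ∙ x ]) ⊢ ((a ∙ x) ∷⁺ [ b ])
    R5-shift a b x = R1 (⊆-reflexive setoid (identityʳ a ∷ comm x b ∷ []))
                        (⊆-reflexive setoid (refl ∷ identityˡ b ∷ []))
                        (R5 a x ε b)
      where open SetoidEquality setoid using (_∷_; [])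

    cancel-translate : ∀ {A B x} → (A ,, (A +ˢ x)) ⊢ B → (A ,, (A -ˢ x)) ⊢ B → A ⊢ B
    cancel-translate {A} {B} {x} A,A+x⊢B A,A-x⊢B =
      cut-map* (_∙ x) (toList A) A,A+x⊢B λ {a} a∈A →
      cut-map* (_∙ x ⁻¹) (toList A) (⊢-weakenʳ (a ∙ x ∷ []) A,A-x⊢B) λ {a′} a′∈A →
      R1 (pair⊆ (member a∈A) (∈-resp-≈ setoid (sym (//-rightDividesˡ x a′)) (member a′∈A)))
         (++⁺ˡ setoid (a′ ∙ x ⁻¹ ∷ []) (xs⊆ys++xs setoid (a ∙ x ∷ []) (toList B)))
         (R5-shift a (a′ ∙ x ⁻¹) x)
      where
      member : ∀ {z zs} → z Propositional.∈ zs → z ∈ zs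
      member = Any.map reflexive

corollary1p3 : {c ℓ₁ ℓ₂ ℓ : Level} (G : CommPreorderedGroup c ℓ₁ ℓ₂)
    → let open CommPreorderedGroup G in
    let open FinSubsets G in
    (_⊢_ : FinSub → FinSub → Set ℓ) → IsRegularEntailment _⊢_
    → (A B : FinSub) (x : Carrier)
    → ((A ,, (A +ˢ x)) ⊢ B → (A ,, (A -ˢ x)) ⊢ B → A ⊢ B)
    × (A ⊢ (B ,, (B +ˢ x)) → A ⊢ (B ,, (B -ˢ x)) → A ⊢ B)
corollary1p3 G _⊢_ R A B x =
  cancel-translate R {A} {B} {x} , cancel-translate (flip-isRegularEntailment R) {B} {A} {x}
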